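{- Let $k\ge 2$ and $i\in\{1,\dots,k-1\}$. If $\binom{k}{i}$ is odd, then for every $\ell\in\{0,1,\dots,k-i\}$ the integer $\binom{k-i}{\ell}\binom{i}{k-i-\ell}\binom{i-2}{k-i-\ell-2}$ is even.
   Context: Binomial coefficients are defined for integer $a$ and $b$ by $\binom{a}{b}=a(a-1)\cdots(a-b+1)/b!$ if $b\ge 0$ and $\binom{a}{b}=0$ if $b<0$ (so for $a\ge 0$ they are the usual ones, equal to $0$ when $b>a$). -}

module Defs where

open import Data.Nat as ℕ using (ℕ; zero; suc)
open import Data.Nat.Properties using (_!≢0)
open import Data.Nat.Base using (_!)
open import Data.Integer using (ℤ; +_; -[1+_]; _*_; _-_)
open import Data.Integer.DivMod using (_/ℕ_)

falling : ℤ → ℕ → ℤ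
falling a zero = + 1
falling a (suc b) = falling a b * (a - + b)

binom : ℤ → ℤ → ℤ
binom a (+ b) = (falling a b /ℕ (b !)) {{b !≢0}}
binom a -[1+ b ] = + 0

-- Over 𝔽₂ Pascal's triangle obeys Lucas's theorem digit by digit, so C(i + m, i) is odd
-- exactly when adding i and m in binary produces no carry, i.e. i and m have no binary
-- digit in common.  Put m = k - i and j = m - ℓ, so that C(m, ℓ) = C(m, j).  By Lucas,
-- C(m, j) and C(i, j) are both odd only if every binary digit of j is a digit of both
-- m and i, which forces j = 0; and for j = 0 the last factor is C(i - 2, -2) = 0.
module Submission where

open import Defs
open import Data.Nat using (ℕ; _≤_; _∸_; _+_)
open import Data.Integer using (ℤ; +_; _-_; _*_)
open import Data.Integer.Divisibility using (_∣_)
open import Relation.Nullary using (¬_)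

open import Data.Bool.Base using (if_then_else_)
open import Data.Bool.Properties using (T-≡)
open import Data.Empty using (⊥-elim)
open import Data.Nat.Base using (zero; suc; _<_; z≤n; s≤s; _!; parity)
open import Data.Nat.Combinatorics
  using (_C_; _P_; nCk≡nPk/k!; nCk≡nC[n∸k]; k>n⇒nCk≡0; nCk+nC[k+1]≡[n+1]C[k+1])
open import Data.Nat.Combinatorics.Base using (_P′_)
open import Data.Nat.DivMod using (_/_; 0/n≡0)
import Data.Nat.Divisibility as ℕ
open import Data.Nat.Induction using (<-wellFounded)
open import Data.Nat.Properties
  using (_!≢0; ≤-<-connex; ≤⇒≤ᵇ; m≤n⇒m∸n≡0; m<n⇒m<1+n; +-suc; n≤1+n; ≤-trans; m+[n∸m]≡n; m∸n≤m)
open import Data.Integer.Properties using ([+m]-[+n]≡m⊖n; ⊖-≥; pos-*; *-comm; *-zeroˡ)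
open import Data.Integer.Divisibility.Signed using (∣ᵤ⇒∣; ∣⇒∣ᵤ; ∣m⇒∣m*n; ∣n⇒∣m*n)
open import Data.Parity.Base as ℙ using (Parity; 0ℙ; 1ℙ)
open import Data.Parity.Properties using (+-homo-+; p≢p⁻¹; p+p≡0ℙ; +-identityʳ)
open import Data.Sum using (inj₁; inj₂)
open import Function.Bundles using (Equivalence)
open import Induction.WellFounded using (Acc; acc)
open import Relation.Binary.PropositionalEquality

+m-+n≡+[m∸n] : ∀ {m n} → n ≤ m → + m - + n ≡ + (m ∸ n)
+m-+n≡+[m∸n] {m} {n} n≤m = trans ([+m]-[+n]≡m⊖n m n) (⊖-≥ n≤m)

nP′k≡0 : ∀ {n k} → n < k → n P′ k ≡ 0
nP′k≡0 {n} {suc k} (s≤s n≤k) rewrite m≤n⇒m∸n≡0 n≤k = refl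

falling-+ : ∀ n k → falling (+ n) k ≡ + (n P′ k)
falling-+ n zero = refl
falling-+ n (suc k) with ≤-<-connex k n
... | inj₁ k≤n = begin
  falling (+ n) k * (+ n - + k)  ≡⟨ cong₂ _*_ (falling-+ n k) (+m-+n≡+[m∸n] k≤n) ⟩
  + (n P′ k) * + (n ∸ k)         ≡⟨ *-comm (+ (n P′ k)) (+ (n ∸ k)) ⟩
  + (n ∸ k) * + (n P′ k)         ≡⟨ pos-* (n ∸ k) (n P′ k) ⟨
  + (n P′ suc k)                 ∎
  where open ≡-Reasoning
... | inj₂ n<k = begin
  falling (+ n) k * (+ n - + k)  ≡⟨ cong (_* (+ n - + k)) (trans (falling-+ n k) (cong +_ (nP′k≡0 n<k))) ⟩
  + 0 * (+ n - + k)              ≡⟨ *-zeroˡ (+ n - + k) ⟩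
  + 0                            ≡⟨ cong +_ (nP′k≡0 (m<n⇒m<1+n n<k)) ⟨
  + (n P′ suc k)                 ∎
  where open ≡-Reasoning

nPk≡nP′k : ∀ {n k} → k ≤ n → n P k ≡ n P′ k
nPk≡nP′k {n} {k} k≤n = cong (λ b → if b then n P′ k else 0) (Equivalence.to T-≡ (≤⇒≤ᵇ k≤n))

nCk≡nP′k/k! : ∀ n k → n C k ≡ ((n P′ k) / k !) {{k !≢0}}
nCk≡nP′k/k! n k with ≤-<-connex k n
... | inj₁ k≤n = trans (nCk≡nPk/k! k≤n) (cong (λ p → (p / k !) {{k !≢0}}) (nPk≡nP′k k≤n))
... | inj₂ n<k = begin
  n C k                      ≡⟨ k>n⇒nCk≡0 n<k ⟩
  0                          ≡⟨ 0/n≡0 (k !) {{k !≢0}} ⟨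
  (0 / k !) {{k !≢0}}        ≡⟨ cong (λ p → (p / k !) {{k !≢0}}) (nP′k≡0 n<k) ⟨
  ((n P′ k) / k !) {{k !≢0}} ∎
  where open ≡-Reasoning

binom-+ : ∀ n k → binom (+ n) (+ k) ≡ + (n C k)
binom-+ n k rewrite falling-+ n k = cong +_ (sym (nCk≡nP′k/k! n k))

binom-sym : ∀ {n k} → k ≤ n → binom (+ n) (+ k) ≡ binom (+ n) (+ (n ∸ k))
binom-sym {n} {k} k≤n = begin
  binom (+ n) (+ k)        ≡⟨ binom-+ n k ⟩
  + (n C k)                ≡⟨ cong +_ (nCk≡nC[n∸k] k≤n) ⟩
  + (n C (n ∸ k))          ≡⟨ binom-+ n (n ∸ k) ⟨
  binom (+ n) (+ (n ∸ k))  ∎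
  where open ≡-Reasoning

infix 8 _C₂_

_C₂_ : ℕ → ℕ → Parity
n     C₂ zero  = 1ℙ
zero  C₂ suc k = 0ℙ
suc n C₂ suc k = n C₂ k ℙ.+ n C₂ suc k

parity-C : ∀ n k → parity (n C k) ≡ n C₂ k
parity-C n       zero    = refl
parity-C zero    (suc k) = refl
parity-C (suc n) (suc k) = begin
  parity (suc n C suc k)                   ≡⟨ cong parity (nCk+nC[k+1]≡[n+1]C[k+1] n k) ⟨
  parity (n C k + n C suc k)               ≡⟨ +-homo-+ (n C k) (n C suc k) ⟩
  parity (n C k) ℙ.+ parity (n C suc k)    ≡⟨ cong₂ ℙ._+_ (parity-C n k) (parity-C n (suc k)) ⟩
  n C₂ k ℙ.+ n C₂ suc k                    ∎
  where open ≡-Reasoning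

parity≡0ℙ⇒2∣ : ∀ n → parity n ≡ 0ℙ → 2 ℕ.∣ n
parity≡0ℙ⇒2∣ zero          _  = 2 ℕ.∣0
parity≡0ℙ⇒2∣ (suc (suc n)) p = ℕ.∣m∣n⇒∣m+n ℕ.∣-refl (parity≡0ℙ⇒2∣ n p)

binom-even : ∀ n k → n C₂ k ≡ 0ℙ → + 2 ∣ binom (+ n) (+ k)
binom-even n k n₂k≡0 =
  subst (+ 2 ∣_) (sym (binom-+ n k)) (parity≡0ℙ⇒2∣ (n C k) (trans (parity-C n k) n₂k≡0))

binom-odd : ∀ n k → ¬ (+ 2 ∣ binom (+ n) (+ k)) → n C₂ k ≡ 1ℙ
binom-odd n k odd with n C₂ k in n₂k
... | 1ℙ = refl
... | 0ℙ = ⊥-elim (odd (binom-even n k n₂k))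

double : ℕ → ℕ
double zero    = zero
double (suc n) = suc (suc (double n))

data Halving : ℕ → Set where
  even : ∀ n → Halving (double n)
  odd  : ∀ n → Halving (suc (double n))

halve : ∀ n → Halving n
halve zero = even zero
halve (suc n) with halve n
... | even h = odd h
... | odd h  = even (suc h)

n≤double[n] : ∀ n → n ≤ double n
n≤double[n] zero    = z≤n
n≤double[n] (suc n) = s≤s (≤-trans (n≤double[n] n) (n≤1+n (double n)))

1+n<double[1+n] : ∀ n → suc n < double (suc n)
1+n<double[1+n] n = s≤s (s≤s (n≤double[n] n))

double-+ : ∀ m n → double m + double n ≡ double (m + n)
double-+ zero    n = refl
double-+ (suc m) n = cong (λ x → suc (suc x)) (double-+ m n)

lucas-even-even : ∀ n k → double n C₂ double k ≡ n C₂ k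
lucas-even-odd  : ∀ n k → double n C₂ suc (double k) ≡ 0ℙ
lucas-odd-even  : ∀ n k → suc (double n) C₂ double k ≡ n C₂ k
lucas-odd-odd   : ∀ n k → suc (double n) C₂ suc (double k) ≡ n C₂ k

lucas-even-even zero    zero    = refl
lucas-even-even zero    (suc k) = refl
lucas-even-even (suc n) zero    = refl
lucas-even-even (suc n) (suc k) = cong₂ ℙ._+_ (lucas-odd-odd n k) (lucas-odd-even n (suc k))

lucas-even-odd zero    k       = refl
lucas-even-odd (suc n) zero    = cong (1ℙ ℙ.+_) (lucas-odd-odd n zero)
lucas-even-odd (suc n) (suc k) =
  trans (cong₂ ℙ._+_ (lucas-odd-even n (suc k)) (lucas-odd-odd n (suc k))) (p+p≡0ℙ (n C₂ suc k))

lucas-odd-even zero    zero    = refl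
lucas-odd-even zero    (suc k) = refl
lucas-odd-even (suc n) zero    = refl
lucas-odd-even (suc n) (suc k) = cong₂ ℙ._+_ (lucas-even-odd (suc n) k) (lucas-even-even (suc n) (suc k))

lucas-odd-odd n k = trans (cong₂ ℙ._+_ (lucas-even-even n k) (lucas-even-odd n k)) (+-identityʳ (n C₂ k))

lucas-sum-even-even : ∀ a b → (double a + double b) C₂ double a ≡ (a + b) C₂ a
lucas-sum-even-even a b rewrite double-+ a b = lucas-even-even (a + b) a

lucas-sum-even-odd : ∀ a b → (double a + suc (double b)) C₂ double a ≡ (a + b) C₂ a
lucas-sum-even-odd a b rewrite +-suc (double a) (double b) | double-+ a b = lucas-odd-even (a + b) a

lucas-sum-odd-even : ∀ a b → (suc (double a) + double b) C₂ suc (double a) ≡ (a + b) C₂ a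
lucas-sum-odd-even a b rewrite double-+ a b = lucas-odd-odd (a + b) a

lucas-sum-odd-odd : ∀ a b → (suc (double a) + suc (double b)) C₂ suc (double a) ≡ 0ℙ
lucas-sum-odd-odd a b rewrite +-suc (double a) (double b) | double-+ a b = lucas-even-odd (suc (a + b)) a

common-odd⇒≡0 : ∀ i m {j} → Acc _<_ j →
                (i + m) C₂ i ≡ 1ℙ → m C₂ j ≡ 1ℙ → i C₂ j ≡ 1ℙ → j ≡ 0
common-odd⇒≡0 i m {j} (acc smaller) carry-free m₂j i₂j with halve i | halve m | halve j
... | _      | _      | even zero = refl
... | odd a  | odd b  | _         = ⊥-elim (p≢p⁻¹ 0ℙ (trans (sym (lucas-sum-odd-odd a b)) carry-free))
... | _      | even b | odd c     = ⊥-elim (p≢p⁻¹ 0ℙ (trans (sym (lucas-even-odd b c)) m₂j))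
... | even a | _      | odd c     = ⊥-elim (p≢p⁻¹ 0ℙ (trans (sym (lucas-even-odd a c)) i₂j))
... | even a | even b | even (suc c) = cong double (common-odd⇒≡0 a b (smaller (1+n<double[1+n] c))
  (trans (sym (lucas-sum-even-even a b)) carry-free) (trans (sym (lucas-even-even b (suc c))) m₂j)
  (trans (sym (lucas-even-even a (suc c))) i₂j))
... | even a | odd b  | even (suc c) = cong double (common-odd⇒≡0 a b (smaller (1+n<double[1+n] c))
  (trans (sym (lucas-sum-even-odd a b)) carry-free) (trans (sym (lucas-odd-even b (suc c))) m₂j)
  (trans (sym (lucas-even-even a (suc c))) i₂j))
... | odd a  | even b | even (suc c) = cong double (common-odd⇒≡0 a b (smaller (1+n<double[1+n] c))
  (trans (sym (lucas-sum-odd-even a b)) carry-free) (trans (sym (lucas-even-even b (suc c))) m₂j)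
  (trans (sym (lucas-odd-even a (suc c))) i₂j))

∣m⇒∣m*n*o : ∀ d m n o → d ∣ m → d ∣ m * n * o
∣m⇒∣m*n*o d m n o d∣m = ∣⇒∣ᵤ {d} {m * n * o} (∣m⇒∣m*n o (∣m⇒∣m*n n (∣ᵤ⇒∣ {d} {m} d∣m)))

∣n⇒∣m*n*o : ∀ d m n o → d ∣ n → d ∣ m * n * o
∣n⇒∣m*n*o d m n o d∣n = ∣⇒∣ᵤ {d} {m * n * o} (∣m⇒∣m*n o (∣n⇒∣m*n m (∣ᵤ⇒∣ {d} {n} d∣n)))

∣o⇒∣m*n*o : ∀ d m n o → d ∣ o → d ∣ m * n * o
∣o⇒∣m*n*o d m n o d∣o = ∣⇒∣ᵤ {d} {m * n * o} (∣n⇒∣m*n (m * n) (∣ᵤ⇒∣ {d} {o} d∣o))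

2∣binom-product : ∀ i m j (z : ℤ) → (i + m) C₂ i ≡ 1ℙ →
                  + 2 ∣ binom (+ m) (+ j) * binom (+ i) (+ j) * binom z (+ j - + 2)
2∣binom-product i m zero z _ =  -- the last factor binom z (+ 0 - + 2) computes to + 0
  ∣o⇒∣m*n*o (+ 2) (binom (+ m) (+ 0)) (binom (+ i) (+ 0)) (binom z (+ 0 - + 2)) (2 ℕ.∣0)
2∣binom-product i m j@(suc _) z carry-free with m C₂ j in m₂j | i C₂ j in i₂j
... | 0ℙ | _  = ∣m⇒∣m*n*o (+ 2) (binom (+ m) (+ j)) (binom (+ i) (+ j)) (binom z (+ j - + 2))
                  (binom-even m j m₂j)
... | 1ℙ | 0ℙ = ∣n⇒∣m*n*o (+ 2) (binom (+ m) (+ j)) (binom (+ i) (+ j)) (binom z (+ j - + 2))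
                  (binom-even i j i₂j)
... | 1ℙ | 1ℙ with () ← common-odd⇒≡0 i m (<-wellFounded j) carry-free m₂j i₂j

lemma3p13 : (k i ℓ : ℕ) → 2 ≤ k → 1 ≤ i → i ≤ k ∸ 1 →
            ¬ (+ 2 ∣ binom (+ k) (+ i)) →
            ℓ ≤ k ∸ i →
            + 2 ∣ (binom (+ (k ∸ i)) (+ ℓ) * binom (+ i) (+ (k ∸ i) - + ℓ)
                     * binom (+ i - + 2) (+ (k ∸ i) - + ℓ - + 2))
lemma3p13 k i ℓ _ _ i≤k∸1 C[k,i]-odd ℓ≤k∸i
  rewrite binom-sym ℓ≤k∸i | +m-+n≡+[m∸n] ℓ≤k∸i
  = 2∣binom-product i (k ∸ i) (k ∸ i ∸ ℓ) (+ i - + 2) carry-free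
  where
  i+[k∸i]≡k : i + (k ∸ i) ≡ k
  i+[k∸i]≡k = m+[n∸m]≡n (≤-trans i≤k∸1 (m∸n≤m k 1))

  carry-free : (i + (k ∸ i)) C₂ i ≡ 1ℙ
  carry-free rewrite i+[k∸i]≡k = binom-odd k i C[k,i]-odd
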